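{- The canonical structure $\mathcal{M}_c=(W_c,\leq_c,R_c,V_c)$ is a Chellas model.
   Context: $\mathcal{L}$ is built from propositional variables ($Var$) and $\top,\bot$ by $\wedge,\vee,\to$ and connectives $\phi\mathbin{\Box\!\!\to}\psi$, $\phi\mathbin{\Diamond\!\!\to}\psi$; $\neg\phi:=\phi\to\bot$. The Hilbert system $\mathbb{ICK}$ has axioms: (A0) all $\mathcal{L}$-instances of a complete axiomatization of intuitionistic propositional logic; (A1) $((\phi\mathbin{\Box\!\!\to}\psi)\wedge(\phi\mathbin{\Box\!\!\to}\chi))\leftrightarrow(\phi\mathbin{\Box\!\!\to}(\psi\wedge\chi))$; (A2) $((\phi\mathbin{\Diamond\!\!\to}\psi)\wedge(\phi\mathbin{\Box\!\!\to}\chi))\to(\phi\mathbin{\Diamond\!\!\to}(\psi\wedge\chi))$; (A3) $(\phi\mathbin{\Diamond\!\!\to}(\psi\vee\chi))\leftrightarrow((\phi\mathbin{\Diamond\!\!\to}\psi)\vee(\phi\mathbin{\Diamond\!\!\to}\chi))$; (A4) $((\phi\mathbin{\Diamond\!\!\to}\psi)\to(\phi\mathbin{\Box\!\!\to}\chi))\to(\phi\mathbin{\Box\!\!\to}(\psi\to\chi))$; (A5) $\phi\mathbin{\Box\!\!\to}\top$; (A6) $\neg(\phi\mathbin{\Diamond\!\!\to}\bot)$; rules: modus ponens; from $\phi\leftrightarrow\psi$ infer $(\phi\mathbin{\Box\!\!\to}\chi)\leftrightarrow(\psi\mathbin{\Box\!\!\to}\chi)$ and $(\chi\mathbin{\Box\!\!\to}\phi)\leftrightarrow(\chi\mathbin{\Box\!\!\to}\psi)$;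 and the same two with $\mathbin{\Diamond\!\!\to}$. $\Gamma\vdash\psi$ iff there is a finite sequence ending in $\psi$ each member of which is in $\Gamma$, a theorem, or obtained from earlier members by modus ponens. A pair $(\Gamma,\Delta)$ of sets of formulas is consistent iff there is no finite $\Delta'\subseteq\Delta$ with $\Gamma\vdash\bigvee\Delta'$ ($\bigvee\emptyset=\bot$); maximal iff consistent and $\Gamma\cup\Delta=\mathcal{L}$. Canonical structure: $W_c$ is the set of maximal pairs; $(\Gamma_0,\Delta_0)\leq_c(\Gamma_1,\Delta_1)$ iff $\Gamma_0\subseteq\Gamma_1$; $((\Gamma_0,\Delta_0),X,(\Gamma_1,\Delta_1))\in R_c$ iff there is $\phi\in\mathcal{L}$ with $X=\{(\Gamma,\Delta)\in W_c\mid\phi\in\Gamma\}$, $\{\psi\mid\phi\mathbin{\Box\!\!\to}\psi\in\Gamma_0\}\subseteq\Gamma_1$ and $\{\phi\mathbin{\Diamond\!\!\to}\psi\mid\psi\in\Gamma_1\}\subseteq\Gamma_0$; $V_c(p)=\{(\Gamma,\Delta)\in W_c\mid p\in\Gamma\}$. A Chellas model is $(W,\leq,R,V)$ with $W\neq\emptyset$, $\leq$ a preorder on $W$, $V:Var\to\mathcal{P}(W)$ with upward-closed values, $R\subseteq W\times\mathcal{P}(W)\times W$, writing $R_X(w,v)$ for $(w,X,v)\in R$, such that for all $X\subseteq W$: (c1) if $w\leq w'$ and $R_X(w,v)$ then $R_X(w',v')$ and $v\leq v'$ for some $v'$; (c2) if $R_X(w,v)$ and $v\leq v'$ then $w\leq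 w'$ and $R_X(w',v')$ for some $w'$. -}

module Defs where

open import Level using (Level; 0ℓ; _⊔_) renaming (suc to lsuc)
open import Data.Nat using (ℕ)
open import Data.List using (List; []; _∷_; foldr)
open import Data.List.Relation.Unary.All using (All)
open import Data.Product using (Σ; _×_; _,_; ∃)
open import Data.Sum using (_⊎_)
open import Relation.Nullary using (¬_)
open import Relation.Unary using (Pred; _⊆_; _∈_; _≐_)

Var : Set
Var = ℕ

infixr 7 _∧ᶠ_
infixr 6 _∨ᶠ_
infixr 5 _⇒_ _⇔_
infix 8 _□→_ _◇→_

data Fm : Set where
  var        : Var → Fm
  ⊤ᶠ ⊥ᶠ      : Fm
  _∧ᶠ_ _∨ᶠ_ _⇒_ : Fm → Fm → Fm
  _□→_ _◇→_  : Fm → Fm → Fm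

¬ᶠ_ : Fm → Fm
¬ᶠ φ = φ ⇒ ⊥ᶠ

_⇔_ : Fm → Fm → Fm
φ ⇔ ψ = (φ ⇒ ψ) ∧ᶠ (ψ ⇒ φ)

-- Axioms of ICK.
-- (A0): instances of a fixed complete Hilbert axiomatization of
-- intuitionistic propositional logic (with ⊤, ⊥, ∧, ∨, →).

data Ax : Fm → Set where
  i-K   : ∀ {φ ψ} → Ax (φ ⇒ (ψ ⇒ φ))
  i-S   : ∀ {φ ψ χ} → Ax ((φ ⇒ (ψ ⇒ χ)) ⇒ ((φ ⇒ ψ) ⇒ (φ ⇒ χ)))
  i-∧E₁ : ∀ {φ ψ} → Ax ((φ ∧ᶠ ψ) ⇒ φ)
  i-∧E₂ : ∀ {φ ψ} → Ax ((φ ∧ᶠ ψ) ⇒ ψ)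
  i-∧I  : ∀ {φ ψ} → Ax (φ ⇒ (ψ ⇒ (φ ∧ᶠ ψ)))
  i-∨I₁ : ∀ {φ ψ} → Ax (φ ⇒ (φ ∨ᶠ ψ))
  i-∨I₂ : ∀ {φ ψ} → Ax (ψ ⇒ (φ ∨ᶠ ψ))
  i-∨E  : ∀ {φ ψ χ} → Ax ((φ ⇒ χ) ⇒ ((ψ ⇒ χ) ⇒ ((φ ∨ᶠ ψ) ⇒ χ)))
  i-⊥E  : ∀ {φ} → Ax (⊥ᶠ ⇒ φ)
  i-⊤I  : Ax ⊤ᶠ
  A1 : ∀ {φ ψ χ} → Ax (((φ □→ ψ) ∧ᶠ (φ □→ χ)) ⇔ (φ □→ (ψ ∧ᶠ χ)))
  A2 : ∀ {φ ψ χ} → Ax (((φ ◇→ ψ) ∧ᶠ (φ □→ χ)) ⇒ (φ ◇→ (ψ ∧ᶠ χ)))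
  A3 : ∀ {φ ψ χ} → Ax ((φ ◇→ (ψ ∨ᶠ χ)) ⇔ ((φ ◇→ ψ) ∨ᶠ (φ ◇→ χ)))
  A4 : ∀ {φ ψ χ} → Ax (((φ ◇→ ψ) ⇒ (φ □→ χ)) ⇒ (φ □→ (ψ ⇒ χ)))
  A5 : ∀ {φ} → Ax (φ □→ ⊤ᶠ)
  A6 : ∀ {φ} → Ax (¬ᶠ (φ ◇→ ⊥ᶠ))

data Thm : Fm → Set where
  ax    : ∀ {φ} → Ax φ → Thm φ
  mp    : ∀ {φ ψ} → Thm (φ ⇒ ψ) → Thm φ → Thm ψ
  re□ˡ  : ∀ {φ ψ χ} → Thm (φ ⇔ ψ) → Thm ((φ □→ χ) ⇔ (ψ □→ χ))
  re□ʳ  : ∀ {φ ψ χ} → Thm (φ ⇔ ψ) → Thm ((χ □→ φ) ⇔ (χ □→ ψ))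
  re◇ˡ  : ∀ {φ ψ χ} → Thm (φ ⇔ ψ) → Thm ((φ ◇→ χ) ⇔ (ψ ◇→ χ))
  re◇ʳ  : ∀ {φ ψ χ} → Thm (φ ⇔ ψ) → Thm ((χ ◇→ φ) ⇔ (χ ◇→ ψ))

-- Derivability from a set of premises (finite sequences of premises,
-- theorems and modus ponens steps, presented as derivation trees)
data _⊢_ (Γ : Pred Fm 0ℓ) : Fm → Set where
  hyp : ∀ {φ} → φ ∈ Γ → Γ ⊢ φ
  thm : ∀ {φ} → Thm φ → Γ ⊢ φ
  mp  : ∀ {φ ψ} → Γ ⊢ (φ ⇒ ψ) → Γ ⊢ φ → Γ ⊢ ψ

⋁ : List Fm → Fm
⋁ = foldr _∨ᶠ_ ⊥ᶠ

Consistent : Pred Fm 0ℓ → Pred Fm 0ℓ → Set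
Consistent Γ Δ = ¬ (Σ (List Fm) λ Δ' → All Δ Δ' × Γ ⊢ ⋁ Δ')

Maximal : Pred Fm 0ℓ → Pred Fm 0ℓ → Set
Maximal Γ Δ = Consistent Γ Δ × (∀ φ → φ ∈ Γ ⊎ φ ∈ Δ)

record Wc : Set₁ where
  constructor ⟨_,_,_⟩
  field
    Γ : Pred Fm 0ℓ
    Δ : Pred Fm 0ℓ
    maximal : Maximal Γ Δ
open Wc public

_≤c_ : Wc → Wc → Set
w ≤c v = Γ w ⊆ Γ v

∣_∣c : Fm → Pred Wc 0ℓ
∣ φ ∣c w = φ ∈ Γ w

Rc : Wc → Pred Wc 0ℓ → Wc → Set₁
Rc w X v = Σ Fm λ φ →
    (X ≐ ∣ φ ∣c)
  × (∀ ψ → (φ □→ ψ) ∈ Γ w → ψ ∈ Γ v)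
  × (∀ ψ → ψ ∈ Γ v → (φ ◇→ ψ) ∈ Γ w)

Vc : Var → Pred Wc 0ℓ
Vc p = ∣ var p ∣c

record IsChellasModel {a e ℓX r v : Level} (W : Set a)
    (_≤_ : W → W → Set e)
    (R : W → Pred W ℓX → W → Set r)
    (V : Var → Pred W v) : Set (a ⊔ e ⊔ lsuc ℓX ⊔ r ⊔ v) where
  field
    nonempty : W
    ≤-refl   : ∀ {w} → w ≤ w
    ≤-trans  : ∀ {w u t} → w ≤ u → u ≤ t → w ≤ t
    V-upward : ∀ p {w w'} → w ≤ w' → w ∈ V p → w' ∈ V p
    c1 : ∀ (X : Pred W ℓX) {w w' v} → w ≤ w' → R w X v →
           Σ W λ v' → R w' X v' × v ≤ v'
    c2 : ∀ (X : Pred W ℓX) {w v v'} → R w X v → v ≤ v' →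
           Σ W λ w' → w ≤ w' × R w' X v'

{-# OPTIONS --safe #-}

-- The witnesses for (c1) and (c2) are maximal pairs extending suitable seeds
-- (Lindenbaum's lemma, where excluded middle decides each formula in turn).
-- For (c1) the seed is (Γ v ∪ {ψ | φ □→ ψ ∈ Γ w'}, {ψ | φ ◇→ ψ ∈ Δ w'}): the
-- box-consequents contain ⊤ by (A5) and are closed under ∧ by (A1), so a
-- refutation collapses to one β with β ⇒ ⋁ ψs ∈ Γ v; then (A2) gives
-- φ ◇→ ⋁ ψs ∈ Γ w', which (A3) and (A6) refute.  For (c2) the seed is
-- (Γ w ∪ {φ ◇→ ψ | ψ ∈ Γ v'}, {φ □→ χ | χ ∈ Δ v'}): a refutation gives
-- (φ ◇→ ψ) ⇒ φ □→ ⋁ χs in Γ w, (A4) turns it into φ □→ (ψ ⇒ ⋁ χs) ∈ Γ w,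
-- and then ⋁ χs ∈ Γ v', contradicting the consistency of v'.
module Submission where

open import Defs
open import Level using (0ℓ)
open import Axiom.ExcludedMiddle using (ExcludedMiddle)
open import Data.Empty using (⊥; ⊥-elim)
open import Data.Unit using (⊤; tt)
open import Data.Nat using (ℕ; zero; suc; _⊔_; _≤_; _≤′_; ≤′-refl; ≤′-step)
open import Data.Nat.Properties using (m≤m⊔n; m≤n⊔m; ≤⇒≤′)
open import Data.List using (List; []; _∷_; _++_; concat; cartesianProductWith)
open import Data.List.Relation.Unary.All as All using (All; []; _∷_)
open import Data.List.Relation.Unary.All.Properties using (++⁺)
open import Data.List.Relation.Unary.Any using (here; there)
open import Data.List.Membership.Propositional using () renaming (_∈_ to _∈ˡ_)
open import Data.List.Relation.Binary.Subset.Propositional using () renaming (_⊆_ to _⊆ˡ_)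
open import Data.List.Membership.Propositional.Properties
  using (∈-++⁺ˡ; ∈-++⁺ʳ; ∈-concat⁺′; ∈-cartesianProductWith⁺)
open import Data.Product using (Σ; ∃-syntax; _×_; _,_; proj₁; proj₂)
open import Data.Sum using (_⊎_; inj₁; inj₂)
open import Function using (id; _∘_)
open import Relation.Nullary using (¬_; yes; no)
open import Relation.Unary using (Pred; _⊆_; _∈_; _∉_; ∅; ｛_｝; _∪_; ⋃)
open import Relation.Binary.PropositionalEquality using (_≡_; refl)

private variable
  Θ Θ' G D : Pred Fm 0ℓ
  a b c φ ψ χ : Fm
  L : List Fm

axiom : Ax φ → Θ ⊢ φ
axiom = thm ∘ ax

⇒-const : Θ ⊢ b → Θ ⊢ (a ⇒ b)
⇒-const = mp (axiom i-K)

⇒-refl : Θ ⊢ (a ⇒ a)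
⇒-refl {a = a} = mp (mp (axiom i-S) (axiom (i-K {a} {a ⇒ a}))) (axiom (i-K {a} {a}))

∧-intro : Θ ⊢ a → Θ ⊢ b → Θ ⊢ (a ∧ᶠ b)
∧-intro d e = mp (mp (axiom i-∧I) d) e

∧-elimˡ : Θ ⊢ (a ∧ᶠ b) → Θ ⊢ a
∧-elimˡ = mp (axiom i-∧E₁)

∧-elimʳ : Θ ⊢ (a ∧ᶠ b) → Θ ⊢ b
∧-elimʳ = mp (axiom i-∧E₂)

∨-introˡ : Θ ⊢ a → Θ ⊢ (a ∨ᶠ b)
∨-introˡ = mp (axiom i-∨I₁)

∨-introʳ : Θ ⊢ b → Θ ⊢ (a ∨ᶠ b)
∨-introʳ = mp (axiom i-∨I₂)

∨-elim : Θ ⊢ (a ∨ᶠ b) → Θ ⊢ (a ⇒ c) → Θ ⊢ (b ⇒ c) → Θ ⊢ c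
∨-elim d f g = mp (mp (mp (axiom i-∨E) f) g) d

⊥ᶠ-elim : Θ ⊢ ⊥ᶠ → Θ ⊢ a
⊥ᶠ-elim = mp (axiom i-⊥E)

⇔-to : Θ ⊢ (a ⇔ b) → Θ ⊢ a → Θ ⊢ b
⇔-to d = mp (∧-elimˡ d)

⇔-from : Θ ⊢ (a ⇔ b) → Θ ⊢ b → Θ ⊢ a
⇔-from d = mp (∧-elimʳ d)

⊢-mono : Θ ⊆ Θ' → Θ ⊢ φ → Θ' ⊢ φ
⊢-mono Θ⊆Θ' (hyp p)  = hyp (Θ⊆Θ' p)
⊢-mono Θ⊆Θ' (thm t)  = thm t
⊢-mono Θ⊆Θ' (mp d e) = mp (⊢-mono Θ⊆Θ' d) (⊢-mono Θ⊆Θ' e)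

assume : (Θ ∪ ｛ ψ ｝) ⊢ ψ
assume = hyp (inj₂ refl)

deduction : (Θ ∪ ｛ ψ ｝) ⊢ φ → Θ ⊢ (ψ ⇒ φ)
deduction (hyp (inj₁ p))    = ⇒-const (hyp p)
deduction (hyp (inj₂ refl)) = ⇒-refl
deduction (thm t)           = ⇒-const (thm t)
deduction (mp d e)          = mp (mp (axiom i-S) (deduction d)) (deduction e)

∅⊢⇒Thm : ∅ ⊢ φ → Thm φ
∅⊢⇒Thm (thm t)  = t
∅⊢⇒Thm (mp d e) = mp (∅⊢⇒Thm d) (∅⊢⇒Thm e)

Rule : Fm → Fm → Set₁
Rule a b = ∀ {Θ} → Θ ⊢ a → Θ ⊢ b

rule⇒⊢ : Rule a b → Θ ⊢ (a ⇒ b)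
rule⇒⊢ r = deduction (r assume)

rules⇒Thm⇔ : Rule a b → Rule b a → Thm (a ⇔ b)
rules⇒Thm⇔ r s = ∅⊢⇒Thm (∧-intro (rule⇒⊢ r) (rule⇒⊢ s))

modus-ponens : Rule ((a ⇒ b) ∧ᶠ a) b
modus-ponens d = mp (∧-elimˡ d) (∧-elimʳ d)

□→-monoʳ : Rule a b → Θ ⊢ (φ □→ a) → Θ ⊢ (φ □→ b)
□→-monoʳ r d = ∧-elimʳ (⇔-from (axiom A1) (⇔-to (thm (re□ʳ a⇔a∧b)) d))
  where a⇔a∧b = rules⇒Thm⇔ (λ e → ∧-intro e (r e)) ∧-elimˡ

◇→-monoʳ : Rule a b → Θ ⊢ (φ ◇→ a) → Θ ⊢ (φ ◇→ b)
◇→-monoʳ r d = ⇔-to (thm (re◇ʳ a∨b⇔b)) (⇔-from (axiom A3) (∨-introˡ d))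
  where a∨b⇔b = rules⇒Thm⇔ (λ e → ∨-elim e (rule⇒⊢ r) ⇒-refl) ∨-introʳ

⋁-++ : ∀ L₁ {L₂} → Rule (⋁ L₁ ∨ᶠ ⋁ L₂) (⋁ (L₁ ++ L₂))
⋁-++ []       d = ∨-elim d (rule⇒⊢ ⊥ᶠ-elim) ⇒-refl
⋁-++ (x ∷ L₁) {L₂} d = ∨-elim d (rule⇒⊢ head∨L₁) (rule⇒⊢ (∨-introʳ ∘ ⋁-++ L₁ ∘ ∨-introʳ))
  where
  head∨L₁ : Rule (x ∨ᶠ ⋁ L₁) (⋁ (x ∷ L₁ ++ L₂))
  head∨L₁ e = ∨-elim e (rule⇒⊢ ∨-introˡ) (rule⇒⊢ (∨-introʳ ∘ ⋁-++ L₁ ∘ ∨-introˡ))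

⋁-remove : ∀ L → All (D ∪ ｛ φ ｝) L → ∃[ L' ] All D L' × Rule (⋁ L) (φ ∨ᶠ ⋁ L')
⋁-remove [] [] = [] , [] , ∨-introʳ
⋁-remove (x ∷ L) (inj₁ x∈D ∷ L⊆) =
  let L' , L'⊆D , r = ⋁-remove L L⊆ in
  x ∷ L' , x∈D ∷ L'⊆D ,
  λ d → ∨-elim d (rule⇒⊢ (∨-introʳ ∘ ∨-introˡ))
                 (rule⇒⊢ λ e → ∨-elim (r e) (rule⇒⊢ ∨-introˡ) (rule⇒⊢ (∨-introʳ ∘ ∨-introʳ)))
⋁-remove (x ∷ L) (inj₂ refl ∷ L⊆) =
  let L' , L'⊆D , r = ⋁-remove L L⊆ in
  L' , L'⊆D , λ d → ∨-elim d (rule⇒⊢ ∨-introˡ) (rule⇒⊢ r)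

record Directed (B : Pred Fm 0ℓ) : Set₁ where
  field
    element : ∃[ β ] β ∈ B
    bound   : a ∈ B → b ∈ B → ∃[ c ] c ∈ B × Rule c (a ∧ᶠ b)

⊢-∪-directed : ∀ {B} → Directed B → (Θ ∪ B) ⊢ χ → ∃[ β ] β ∈ B × Θ ⊢ (β ⇒ χ)
⊢-∪-directed dir (hyp (inj₁ p)) = let β , β∈B = Directed.element dir in β , β∈B , ⇒-const (hyp p)
⊢-∪-directed dir (hyp (inj₂ p)) = _ , p , ⇒-refl
⊢-∪-directed dir (thm t) = let β , β∈B = Directed.element dir in β , β∈B , ⇒-const (thm t)
⊢-∪-directed dir (mp d e) =
  let β₁ , β₁∈B , β₁⇒ψ⇒χ = ⊢-∪-directed dir d
      β₂ , β₂∈B , β₂⇒ψ   = ⊢-∪-directed dir e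
      γ , γ∈B , r        = Directed.bound dir β₁∈B β₂∈B
  in γ , γ∈B , deduction (mp (mp (⊢-mono inj₁ β₁⇒ψ⇒χ) (∧-elimˡ (r assume)))
                             (mp (⊢-mono inj₁ β₂⇒ψ) (∧-elimʳ (r assume))))

module _ (w : Wc) where

  Γ-closed : Γ w ⊢ φ → φ ∈ Γ w
  Γ-closed {φ} d with proj₂ (maximal w) φ
  ... | inj₁ φ∈Γ = φ∈Γ
  ... | inj₂ φ∈Δ = ⊥-elim (proj₁ (maximal w) (φ ∷ [] , φ∈Δ ∷ [] , ∨-introˡ d))

  Γ-prime : (a ∨ᶠ b) ∈ Γ w → a ∈ Γ w ⊎ b ∈ Γ w
  Γ-prime {a} {b} a∨b∈Γ with proj₂ (maximal w) a | proj₂ (maximal w) b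
  ... | inj₁ a∈Γ | _         = inj₁ a∈Γ
  ... | inj₂ _   | inj₁ b∈Γ  = inj₂ b∈Γ
  ... | inj₂ a∈Δ | inj₂ b∈Δ  =
    ⊥-elim (proj₁ (maximal w) (a ∷ b ∷ [] , a∈Δ ∷ b∈Δ ∷ [] ,
      ∨-elim (hyp a∨b∈Γ) (rule⇒⊢ ∨-introˡ) (rule⇒⊢ (∨-introʳ ∘ ∨-introˡ))))

  Γ-disjoint-Δ : φ ∈ Γ w → φ ∉ Δ w
  Γ-disjoint-Δ {φ} φ∈Γ φ∈Δ = proj₁ (maximal w) (φ ∷ [] , φ∈Δ ∷ [] , ∨-introˡ (hyp φ∈Γ))

  ⊥ᶠ∉Γ : ⊥ᶠ ∉ Γ w
  ⊥ᶠ∉Γ ⊥ᶠ∈Γ = proj₁ (maximal w) ([] , [] , hyp ⊥ᶠ∈Γ)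

Δ-transfer⇒Γ-transfer : ∀ w v (f g : Fm → Fm) →
  (∀ x → f x ∈ Δ w → g x ∈ Δ v) → ∀ x → g x ∈ Γ v → f x ∈ Γ w
Δ-transfer⇒Γ-transfer w v f g Δ-transfer x gx∈Γv with proj₂ (maximal w) (f x)
... | inj₁ fx∈Γw = fx∈Γw
... | inj₂ fx∈Δw = ⊥-elim (Γ-disjoint-Δ v gx∈Γv (Δ-transfer x fx∈Δw))

-- Lindenbaum's lemma

record Pair : Set₁ where
  constructor ⟪_,_,_⟫
  field
    lhs rhs    : Pred Fm 0ℓ
    consistent : Consistent lhs rhs
open Pair

record _⊑_ (p q : Pair) : Set where
  constructor _,_
  field
    lhs-⊆ : lhs p ⊆ lhs q
    rhs-⊆ : rhs p ⊆ rhs q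
open _⊑_

⊑-trans : ∀ {p q r} → p ⊑ q → q ⊑ r → p ⊑ r
⊑-trans (l₁ , r₁) (l₂ , r₂) = l₂ ∘ l₁ , r₂ ∘ r₁

Decides : Fm → Pair → Set
Decides φ p = φ ∈ lhs p ⊎ φ ∈ rhs p

Decides-⊑ : ∀ {p q} → p ⊑ q → Decides φ p → Decides φ q
Decides-⊑ (l , _) (inj₁ φ∈lhs) = inj₁ (l φ∈lhs)
Decides-⊑ (_ , r) (inj₂ φ∈rhs) = inj₂ (r φ∈rhs)

consistent-∪ʳ : Consistent G D → ¬ Consistent (G ∪ ｛ φ ｝) D → Consistent G (D ∪ ｛ φ ｝)
consistent-∪ʳ c ¬c (L , L⊆ , G⊢⋁L) =
  let L' , L'⊆D , r = ⋁-remove L L⊆ in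
  ¬c λ (L₁ , L₁⊆D , Gφ⊢⋁L₁) →
    c (L₁ ++ L' , ++⁺ L₁⊆D L'⊆D ,
       ⋁-++ L₁ (∨-elim (r G⊢⋁L) (deduction (∨-introˡ Gφ⊢⋁L₁)) (rule⇒⊢ ∨-introʳ)))

module _ (chain : ℕ → Pair) (mono : ∀ {m n} → m ≤ n → chain m ⊑ chain n) where

  ⊢-stage : ⋃ ℕ (lhs ∘ chain) ⊢ χ → ∃[ n ] lhs (chain n) ⊢ χ
  ⊢-stage (hyp (n , p)) = n , hyp p
  ⊢-stage (thm t)       = 0 , thm t
  ⊢-stage (mp d e) =
    let m , d′ = ⊢-stage d
        n , e′ = ⊢-stage e
    in m ⊔ n , mp (⊢-mono (lhs-⊆ (mono (m≤m⊔n m n))) d′) (⊢-mono (lhs-⊆ (mono (m≤n⊔m m n))) e′)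

  All-stage : All (⋃ ℕ (rhs ∘ chain)) L → ∃[ n ] All (rhs (chain n)) L
  All-stage [] = 0 , []
  All-stage ((m , p) ∷ ps) =
    let n , qs = All-stage ps
    in m ⊔ n , rhs-⊆ (mono (m≤m⊔n m n)) p ∷ All.map (rhs-⊆ (mono (m≤n⊔m m n))) qs

  ⋃-consistent : Consistent (⋃ ℕ (lhs ∘ chain)) (⋃ ℕ (rhs ∘ chain))
  ⋃-consistent (L , L⊆ , d) =
    let m , d′  = ⊢-stage d
        n , L⊆′ = All-stage L⊆
    in consistent (chain (m ⊔ n))
         (L , All.map (rhs-⊆ (mono (m≤n⊔m m n))) L⊆′ , ⊢-mono (lhs-⊆ (mono (m≤m⊔n m n))) d′)

compounds : Fm → Fm → List Fm
compounds a b = a ∧ᶠ b ∷ a ∨ᶠ b ∷ (a ⇒ b) ∷ a □→ b ∷ a ◇→ b ∷ []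

formulasUpTo : ℕ → List Fm
formulasUpTo zero    = ⊤ᶠ ∷ ⊥ᶠ ∷ var zero ∷ []
formulasUpTo (suc n) = var (suc n) ∷ Fs ++ concat (cartesianProductWith compounds Fs Fs)
  where Fs = formulasUpTo n

formulasUpTo-mono : ∀ {m n} → m ≤′ n → formulasUpTo m ⊆ˡ formulasUpTo n
formulasUpTo-mono ≤′-refl        = id
formulasUpTo-mono (≤′-step m≤′n) = there ∘ ∈-++⁺ˡ ∘ formulasUpTo-mono m≤′n

compound-enumerated : c ∈ˡ compounds a b → ∃[ n ] a ∈ˡ formulasUpTo n → ∃[ n ] b ∈ˡ formulasUpTo n →
  ∃[ n ] c ∈ˡ formulasUpTo n
compound-enumerated c∈ (m , a∈) (n , b∈) =
  suc (m ⊔ n) , there (∈-++⁺ʳ (formulasUpTo (m ⊔ n)) (∈-concat⁺′ c∈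
    (∈-cartesianProductWith⁺ compounds (formulasUpTo-mono (≤⇒≤′ (m≤m⊔n m n)) a∈)
                                       (formulasUpTo-mono (≤⇒≤′ (m≤n⊔m m n)) b∈))))

enumerated : ∀ φ → ∃[ n ] φ ∈ˡ formulasUpTo n
enumerated (var zero)    = 0 , there (there (here refl))
enumerated (var (suc k)) = suc k , here refl
enumerated ⊤ᶠ            = 0 , here refl
enumerated ⊥ᶠ            = 0 , there (here refl)
enumerated (a ∧ᶠ b) = compound-enumerated (here refl) (enumerated a) (enumerated b)
enumerated (a ∨ᶠ b) = compound-enumerated (there (here refl)) (enumerated a) (enumerated b)
enumerated (a ⇒ b)  = compound-enumerated (there (there (here refl))) (enumerated a) (enumerated b)
enumerated (a □→ b) = compound-enumerated (there (there (there (here refl)))) (enumerated a) (enumerated b)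
enumerated (a ◇→ b) =
  compound-enumerated (there (there (there (there (here refl))))) (enumerated a) (enumerated b)

module Lindenbaum (lem : ExcludedMiddle 0ℓ) where

  decide : Pair → Fm → Pair
  decide ⟪ G , D , c ⟫ φ with lem {Consistent (G ∪ ｛ φ ｝) D}
  ... | yes c∪ˡ = ⟪ G ∪ ｛ φ ｝ , D , c∪ˡ ⟫
  ... | no ¬c∪ˡ = ⟪ G , D ∪ ｛ φ ｝ , consistent-∪ʳ c ¬c∪ˡ ⟫

  decide-⊑ : ∀ p φ → p ⊑ decide p φ
  decide-⊑ ⟪ G , D , c ⟫ φ with lem {Consistent (G ∪ ｛ φ ｝) D}
  ... | yes _ = inj₁ , id
  ... | no _  = id , inj₁

  decide-decides : ∀ p φ → Decides φ (decide p φ)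
  decide-decides ⟪ G , D , c ⟫ φ with lem {Consistent (G ∪ ｛ φ ｝) D}
  ... | yes _ = inj₁ (inj₂ refl)
  ... | no _  = inj₂ (inj₂ refl)

  decideAll : Pair → List Fm → Pair
  decideAll p []      = p
  decideAll p (φ ∷ L) = decideAll (decide p φ) L

  decideAll-⊑ : ∀ p L → p ⊑ decideAll p L
  decideAll-⊑ p []      = id , id
  decideAll-⊑ p (φ ∷ L) = ⊑-trans (decide-⊑ p φ) (decideAll-⊑ (decide p φ) L)

  decideAll-decides : ∀ p L → φ ∈ˡ L → Decides φ (decideAll p L)
  decideAll-decides p (φ ∷ L) (here refl) = Decides-⊑ (decideAll-⊑ (decide p φ) L) (decide-decides p φ)
  decideAll-decides p (ψ ∷ L) (there φ∈L) = decideAll-decides (decide p ψ) L φ∈L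

  stage : Pair → ℕ → Pair
  stage p zero    = p
  stage p (suc n) = decideAll (stage p n) (formulasUpTo n)

  stage-mono′ : ∀ p {m n} → m ≤′ n → stage p m ⊑ stage p n
  stage-mono′ p ≤′-refl                = id , id
  stage-mono′ p (≤′-step {n = n} m≤′n) =
    ⊑-trans (stage-mono′ p m≤′n) (decideAll-⊑ (stage p n) (formulasUpTo n))

  lindenbaum : Consistent G D → Σ Wc λ w → G ⊆ Γ w × D ⊆ Δ w
  lindenbaum {G} {D} c =
    ⟨ ⋃ ℕ (lhs ∘ chain) , ⋃ ℕ (rhs ∘ chain) , (⋃-consistent chain mono , total) ⟩ ,
    (λ φ∈G → 0 , φ∈G) , (λ φ∈D → 0 , φ∈D)
    where
    chain = stage ⟪ G , D , c ⟫
    mono : ∀ {m n} → m ≤ n → chain m ⊑ chain n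
    mono = stage-mono′ ⟪ G , D , c ⟫ ∘ ≤⇒≤′
    total : ∀ φ → φ ∈ ⋃ ℕ (lhs ∘ chain) ⊎ φ ∈ ⋃ ℕ (rhs ∘ chain)
    total φ with enumerated φ
    ... | n , φ∈ with decideAll-decides (chain n) (formulasUpTo n) φ∈
    ... | inj₁ φ∈lhs = inj₁ (suc n , φ∈lhs)
    ... | inj₂ φ∈rhs = inj₂ (suc n , φ∈rhs)

open Lindenbaum using (lindenbaum)

-- Consistency of ICK

⟦_⟧ : Fm → Set
⟦ var _ ⟧  = ⊥
⟦ ⊤ᶠ ⟧     = ⊤
⟦ ⊥ᶠ ⟧     = ⊥
⟦ a ∧ᶠ b ⟧ = ⟦ a ⟧ × ⟦ b ⟧
⟦ a ∨ᶠ b ⟧ = ⟦ a ⟧ ⊎ ⟦ b ⟧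
⟦ a ⇒ b ⟧  = ⟦ a ⟧ → ⟦ b ⟧
⟦ _ □→ _ ⟧ = ⊤
⟦ _ ◇→ _ ⟧ = ⊥

Ax-sound : Ax φ → ⟦ φ ⟧
Ax-sound i-K   = λ x _ → x
Ax-sound i-S   = λ f g x → f x (g x)
Ax-sound i-∧E₁ = proj₁
Ax-sound i-∧E₂ = proj₂
Ax-sound i-∧I  = _,_
Ax-sound i-∨I₁ = inj₁
Ax-sound i-∨I₂ = inj₂
Ax-sound i-∨E  = λ f g → λ { (inj₁ x) → f x ; (inj₂ y) → g y }
Ax-sound i-⊥E  = λ ()
Ax-sound i-⊤I  = tt
Ax-sound A1    = (λ _ → tt) , (λ _ → tt , tt)
Ax-sound A2    = proj₁
Ax-sound A3    = inj₁ , λ { (inj₁ x) → x ; (inj₂ y) → y }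
Ax-sound A4    = λ _ → tt
Ax-sound A5    = tt
Ax-sound A6    = id

Thm-sound : Thm φ → ⟦ φ ⟧
Thm-sound (ax a)   = Ax-sound a
Thm-sound (mp t u) = Thm-sound t (Thm-sound u)
Thm-sound (re□ˡ _) = (λ _ → tt) , (λ _ → tt)
Thm-sound (re□ʳ _) = (λ _ → tt) , (λ _ → tt)
Thm-sound (re◇ˡ _) = id , id
Thm-sound (re◇ʳ _) = id , id

∅-consistent : Consistent ∅ ∅
∅-consistent ([] , [] , ∅⊢⊥ᶠ) = Thm-sound (∅⊢⇒Thm ∅⊢⊥ᶠ)

-- The frame conditions

_□→⁻¹_ : Fm → Pred Fm 0ℓ → Pred Fm 0ℓ
(φ □→⁻¹ P) ψ = (φ □→ ψ) ∈ P

_◇→⁻¹_ : Fm → Pred Fm 0ℓ → Pred Fm 0ℓ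
(φ ◇→⁻¹ P) ψ = (φ ◇→ ψ) ∈ P

_□→[_] : Fm → Pred Fm 0ℓ → Pred Fm 0ℓ
(φ □→[ P ]) x = ∃[ ψ ] ψ ∈ P × x ≡ (φ □→ ψ)

_◇→[_] : Fm → Pred Fm 0ℓ → Pred Fm 0ℓ
(φ ◇→[ P ]) x = ∃[ ψ ] ψ ∈ P × x ≡ (φ ◇→ ψ)

□→⁻¹-directed : ∀ w φ → Directed (φ □→⁻¹ Γ w)
□→⁻¹-directed w φ = record
  { element = ⊤ᶠ , Γ-closed w (axiom A5)
  ; bound   = λ a∈ b∈ →
      _ , Γ-closed w (⇔-to (axiom A1) (∧-intro (hyp a∈) (hyp b∈))) , id
  }

◇→[]-directed : ∀ v φ → Directed (φ ◇→[ Γ v ])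
◇→[]-directed v φ = record
  { element = φ ◇→ ⊤ᶠ , ⊤ᶠ , Γ-closed v (axiom i-⊤I) , refl
  ; bound   = λ where
      (ψ₁ , ψ₁∈ , refl) (ψ₂ , ψ₂∈ , refl) →
        φ ◇→ (ψ₁ ∧ᶠ ψ₂) , (ψ₁ ∧ᶠ ψ₂ , Γ-closed v (∧-intro (hyp ψ₁∈) (hyp ψ₂∈)) , refl) ,
        λ d → ∧-intro (◇→-monoʳ ∧-elimˡ d) (◇→-monoʳ ∧-elimʳ d)
  }

◇→⋁∉Γ : ∀ w φ L → All (φ ◇→⁻¹ Δ w) L → (φ ◇→ ⋁ L) ∉ Γ w
◇→⋁∉Γ w φ [] [] φ◇→⊥ᶠ∈Γ = ⊥ᶠ∉Γ w (Γ-closed w (mp (axiom A6) (hyp φ◇→⊥ᶠ∈Γ)))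
◇→⋁∉Γ w φ (x ∷ L) (x∈ ∷ L⊆) φ◇→⋁∈Γ
  with Γ-prime w (Γ-closed w (⇔-to (axiom A3) (hyp φ◇→⋁∈Γ)))
... | inj₁ φ◇→x∈Γ = Γ-disjoint-Δ w φ◇→x∈Γ x∈
... | inj₂ φ◇→⋁L∈Γ = ◇→⋁∉Γ w φ L L⊆ φ◇→⋁L∈Γ

⋁-□→[] : ∀ L → All (φ □→[ D ]) L → ∃[ χs ] All D χs × Rule (⋁ L) (φ □→ ⋁ χs)
⋁-□→[] [] [] = [] , [] , ⊥ᶠ-elim
⋁-□→[] (_ ∷ L) ((χ , χ∈D , refl) ∷ L⊆) =
  let χs , χs⊆D , r = ⋁-□→[] L L⊆ in
  χ ∷ χs , χ∈D ∷ χs⊆D ,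
  λ d → ∨-elim d (rule⇒⊢ (□→-monoʳ ∨-introˡ)) (rule⇒⊢ (□→-monoʳ ∨-introʳ ∘ r))

c1-seed-consistent : ∀ w v φ → (∀ ψ → ψ ∈ Γ v → (φ ◇→ ψ) ∈ Γ w) →
  Consistent (Γ v ∪ φ □→⁻¹ Γ w) (φ ◇→⁻¹ Δ w)
c1-seed-consistent w v φ diamonds (L , L⊆ , d) =
  let β , φ□→β∈Γw , β⇒⋁L = ⊢-∪-directed (□→⁻¹-directed w φ) d
      φ◇→[β⇒⋁L] = hyp (diamonds _ (Γ-closed v β⇒⋁L))
  in ◇→⋁∉Γ w φ L L⊆
       (Γ-closed w (◇→-monoʳ modus-ponens (mp (axiom A2) (∧-intro φ◇→[β⇒⋁L] (hyp φ□→β∈Γw)))))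

c2-seed-consistent : ∀ w v φ → (∀ ψ → (φ □→ ψ) ∈ Γ w → ψ ∈ Γ v) →
  Consistent (Γ w ∪ φ ◇→[ Γ v ]) (φ □→[ Δ v ])
c2-seed-consistent w v φ boxes (L , L⊆ , d) with ⊢-∪-directed (◇→[]-directed v φ) d
... | _ , (ψ , ψ∈Γv , refl) , φ◇→ψ⇒⋁L =
  let χs , χs⊆Δv , r = ⋁-□→[] L L⊆
      φ◇→ψ⇒φ□→⋁χs = deduction (r (mp (⊢-mono inj₁ φ◇→ψ⇒⋁L) assume))
      φ□→[ψ⇒⋁χs]∈Γw = Γ-closed w (mp (axiom A4) φ◇→ψ⇒φ□→⋁χs)
  in proj₁ (maximal v) (χs , χs⊆Δv , mp (hyp (boxes _ φ□→[ψ⇒⋁χs]∈Γw)) (hyp ψ∈Γv))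

module _ (lem : ExcludedMiddle 0ℓ) where

  c1 : ∀ (X : Pred Wc 0ℓ) {w w' v} → w ≤c w' → Rc w X v →
       Σ Wc λ v' → Rc w' X v' × v ≤c v'
  c1 X {w' = w'} {v} w≤w' (φ , X≐ , _ , diamonds) =
    let v' , seed⊆Γ , seed⊆Δ =
          lindenbaum lem (c1-seed-consistent w' v φ λ ψ → w≤w' ∘ diamonds ψ)
    in v' , (φ , X≐ , (λ _ → seed⊆Γ ∘ inj₂) ,
             Δ-transfer⇒Γ-transfer w' v' (φ ◇→_) id (λ _ → seed⊆Δ)) ,
       seed⊆Γ ∘ inj₁

  c2 : ∀ (X : Pred Wc 0ℓ) {w v v'} → Rc w X v → v ≤c v' →
       Σ Wc λ w' → w ≤c w' × Rc w' X v'
  c2 X {w} {v' = v'} (φ , X≐ , boxes , _) v≤v' =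
    let w' , seed⊆Γ , seed⊆Δ =
          lindenbaum lem (c2-seed-consistent w v' φ λ ψ → v≤v' ∘ boxes ψ)
    in w' , seed⊆Γ ∘ inj₁ ,
       (φ , X≐ ,
        Δ-transfer⇒Γ-transfer v' w' id (φ □→_) (λ ψ ψ∈Δ → seed⊆Δ (ψ , ψ∈Δ , refl)) ,
        λ ψ ψ∈Γ → seed⊆Γ (inj₂ (ψ , ψ∈Γ , refl)))

lemma10 : ExcludedMiddle 0ℓ → IsChellasModel Wc _≤c_ Rc Vc
lemma10 lem = record
  { nonempty = proj₁ (lindenbaum lem ∅-consistent)
  ; ≤-refl   = id
  ; ≤-trans  = λ w≤u u≤t → u≤t ∘ w≤u
  ; V-upward = λ _ w≤w' → w≤w'
  ; c1       = c1 lem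
  ; c2       = c2 lem
  }
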